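{- Let $H$ be a type B or type C Hessenberg space with $t_{n-1}\notin S(H)$. Then $\mathbf{h}\in\mathcal{M}_H$.
   Context: Let $n\ge 2$, $[n]=\{1,\dots,n\}$, $[\bar n]=\{\pm1,\dots,\pm n\}$, $\bar i=-i$. $\mathfrak{W}_n$ is the group of bijections $w$ of $[\bar n]$ with $w(\bar i)=\overline{w(i)}$. For $p,q\in[\bar n]$, $q\ne\pm p$, $(p,q)$ exchanges $p\leftrightarrow q$, $\bar p\leftrightarrow\bar q$; $(p,\bar p)$ exchanges $p,\bar p$. $\mathrm{Neg}(w)=\{w(i):i\in[n],w(i)<0\}$. Roots: type B $\Phi^+=\{e_i\pm e_j:i<j\}\cup\{e_i\}$, $\alpha_i=e_i-e_{i+1}$, $\alpha_n=e_n$; type C $\Phi^+=\{e_i\pm e_j\}\cup\{2e_i\}$, $\alpha_n=2e_n$; $\Delta=\{\alpha_i\}$; $\alpha\le\beta$ iff $\beta-\alpha$ is a nonnegative integer combination of simple roots. A Hessenberg space is a lower order ideal $H\supseteq\Delta$ of $\Phi^+$. Reflections: $e_i-e_j\mapsto(i,j)$, $e_i+e_j\mapsto(i,\bar j)$, $e_i$ or $2e_i\mapsto(i,\bar i)$; $S(H)$ = reflections of roots in $H$. $t_{n-1}=(n-1,\overline{n-1})$. With $x_{\bar k}:=-x_k$, $\mathcal{M}_H$ is the set of $\rho:\mathfrak{W}_n\to\mathbb{C}[x_1,\dots,x_n]$ with $\rho(w)-\rho(ws)\in\langle x_{w(p)}-x_{w(q)}\rangle$ for all $w$ and all $s\in S(H)$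 exchanging $p$ and $q$ ($q\ne p$, possibly $q=\bar p$). $\mathbf{h}(w)=x_{w(n)}$ if $|\mathrm{Neg}(w)|$ is odd and $0$ otherwise. -}

module Defs where

open import Level using (Level; _⊔_)
open import Data.Bool using (Bool; true; false; not; _xor_; if_then_else_; _∨_)
open import Data.Nat as ℕ using (ℕ; zero; suc; _%_; _≡ᵇ_)
open import Data.Integer as ℤ using (ℤ; +_)
open import Data.Fin as Fin using (Fin; toℕ; fromℕ; inject₁; _≟_)
open import Data.Fin.Permutation.Components as PC using (transpose; transpose-inverse)
open import Data.Product using (Σ; _×_; _,_; proj₁; proj₂)
open import Data.List using (List; []; _∷_; _++_; map; concatMap)
open import Data.Vec as Vec using (Vec; replicate; zipWith; _[_]≔_)
open import Data.Vec.Properties using (≡-dec)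
open import Function using (_∘_; id)
open import Relation.Nullary using (¬_; does)
open import Relation.Binary.PropositionalEquality using (_≡_; _≢_; refl; cong; cong₂; trans; sym)
open import Algebra.Bundles using (CommutativeRing)

-- Signed integers [n̄] = {±1,…,±n}.
-- (false , k) encodes the positive element k+1, (true , k) encodes -(k+1).

SI : ℕ → Set
SI n = Bool × Fin n

neg : ∀ {n} → SI n → SI n
neg (b , k) = (not b , k)

record W (n : ℕ) : Set where
  field
    fun     : SI n → SI n
    inv     : SI n → SI n
    fun-inv : ∀ x → fun (inv x) ≡ x
    inv-fun : ∀ x → inv (fun x) ≡ x
    odd     : ∀ x → fun (neg x) ≡ neg (fun x)
open W public

_∙_ : ∀ {n} → W n → W n → W n
w ∙ s = record
  { fun     = fun w ∘ fun s
  ; inv     = inv s ∘ inv w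
  ; fun-inv = λ x → trans (cong (fun w) (fun-inv s (inv w x))) (fun-inv w x)
  ; inv-fun = λ x → trans (cong (inv s) (inv-fun w (fun s x))) (inv-fun s x)
  ; odd     = λ x → trans (cong (fun w) (odd s x)) (odd w (fun s x))
  }

private
  xor-cancel : ∀ b c → (b xor c) xor c ≡ b
  xor-cancel false false = refl
  xor-cancel false true  = refl
  xor-cancel true  false = refl
  xor-cancel true  true  = refl

  not-xor : ∀ b c → not b xor c ≡ not (b xor c)
  not-xor false false = refl
  not-xor false true  = refl
  not-xor true  false = refl
  not-xor true  true  = refl

signedPerm : ∀ {n} (τ τ' : Fin n → Fin n) (c : Fin n → Bool) →
             (∀ k → τ (τ' k) ≡ k) → (∀ k → τ' (τ k) ≡ k) → W n
signedPerm τ τ' c ττ' τ'τ = record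
  { fun     = λ { (b , k) → (b xor c k , τ k) }
  ; inv     = λ { (b , k) → (b xor c (τ' k) , τ' k) }
  ; fun-inv = λ { (b , k) → cong₂ _,_ (xor-cancel b (c (τ' k))) (ττ' k) }
  ; inv-fun = λ { (b , k) → cong₂ _,_
                   (trans (cong (λ z → (b xor c k) xor c z) (τ'τ k)) (xor-cancel b (c k)))
                   (τ'τ k) }
  ; odd     = λ { (b , k) → cong (_, τ k) (not-xor b (c k)) }
  }

-- Positive roots of type B / C (the combinatorial data is the same).

data Typ : Set where
  B C : Typ

data Root (n : ℕ) : Set where
  minus : (i j : Fin n) → i Fin.< j → Root n
  plus  : (i j : Fin n) → i Fin.< j → Root n
  short : (i : Fin n) → Root n

e : ∀ {n} → Fin n → Fin n → ℤ
e i m = if does (i ≟ m) then ℤ.1ℤ else ℤ.0ℤ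

rootVec : ∀ {n} → Typ → Root n → Fin n → ℤ
rootVec t (minus i j _) m = e i m ℤ.- e j m
rootVec t (plus  i j _) m = e i m ℤ.+ e j m
rootVec B (short i)     m = e i m
rootVec C (short i)     m = + 2 ℤ.* e i m

-- simple roots α_k (k = 0,…,n-1 encodes α_1,…,α_n):
-- α_k = e_k - e_{k+1} for k < n-1, α_{n-1} = e_{n-1} (B) or 2 e_{n-1} (C)
simpleVec : ∀ {n} → Typ → Fin n → Fin n → ℤ
simpleVec {n} t k m with suc (toℕ k) ≡ᵇ n
... | true  = rootVec t (short k) m
... | false = e k m ℤ.- (if toℕ m ≡ᵇ suc (toℕ k) then ℤ.1ℤ else ℤ.0ℤ)

sumℤ : ∀ {n} → (Fin n → ℤ) → ℤ
sumℤ {zero}  f = ℤ.0ℤ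
sumℤ {suc n} f = f Fin.zero ℤ.+ sumℤ (f ∘ Fin.suc)

sumℕ : ∀ {n} → (Fin n → ℕ) → ℕ
sumℕ {zero}  f = 0
sumℕ {suc n} f = f Fin.zero ℕ.+ sumℕ (f ∘ Fin.suc)

_⊑[_]_ : ∀ {n} → Root n → Typ → Root n → Set
_⊑[_]_ {n} α t β = Σ (Fin n → ℕ) λ c →
  ∀ m → rootVec t β m ℤ.- rootVec t α m ≡ sumℤ (λ k → + c k ℤ.* simpleVec t k m)

IsSimple : ∀ {n} → Typ → Root n → Set
IsSimple {n} t α = Σ (Fin n) λ k → ∀ m → rootVec t α m ≡ simpleVec t k m

IsHessenberg : ∀ {n} → Typ → (Root n → Set) → Set
IsHessenberg t H =
  (∀ α β → α ⊑[ t ] β → H β → H α) × (∀ α → IsSimple t α → H α)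

-- Reflections: e_i - e_j ↦ (i,j), e_i + e_j ↦ (i,j̄), e_i / 2e_i ↦ (i,ī)

refl-of : ∀ {n} → Root n → W n
refl-of (minus i j _) =
  signedPerm (transpose i j) (transpose j i) (λ _ → false)
             (λ k → transpose-inverse i j) (λ k → transpose-inverse j i)
refl-of (plus i j _) =
  signedPerm (transpose i j) (transpose j i) (λ k → does (k ≟ i) ∨ does (k ≟ j))
             (λ k → transpose-inverse i j) (λ k → transpose-inverse j i)
refl-of (short i) =
  signedPerm id id (λ k → does (k ≟ i)) (λ k → refl) (λ k → refl)

-- s ∈ S(H)  (equality of group elements = equality of the maps on [n̄])
InS : ∀ {n} → (Root n → Set) → W n → Set
InS {n} H s = Σ (Root n) λ α → H α × (∀ x → fun (refl-of α) x ≡ fun s x)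

-- t_{n-1} = (n-1, \overline{n-1}) for n = m + 2 (Fin index m encodes n-1)
t-n-1 : (m : ℕ) → W (suc (suc m))
t-n-1 m = refl-of (short (inject₁ (fromℕ m)))

negCount : ∀ {n} → W n → ℕ
negCount w = sumℕ (λ i → if proj₁ (fun w (false , i)) then 1 else 0)

module Poly {c ℓ : Level} (R : CommutativeRing c ℓ) where
  open CommutativeRing R

  natCast : ℕ → Carrier
  natCast zero    = 0#
  natCast (suc k) = 1# + natCast k

  IsChar0Field : Set (c ⊔ ℓ)
  IsChar0Field =
    (∀ a → ¬ (a ≈ 0#) → Σ Carrier λ b → a * b ≈ 1#) ×
    (∀ k → natCast k ≈ 0# → k ≡ 0)

  -- a polynomial is a finite formal sum of terms  a · x^e
  Mono : ℕ → Set
  Mono n = Vec ℕ n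

  P : ℕ → Set c
  P n = List (Carrier × Mono n)

  coeff : ∀ {n} → P n → Mono n → Carrier
  coeff []             μ = 0#
  coeff ((a , ν) ∷ p) μ = (if does (≡-dec ℕ._≟_ ν μ) then a else 0#) + coeff p μ

  _≈P_ : ∀ {n} → P n → P n → Set ℓ
  p ≈P q = ∀ μ → coeff p μ ≈ coeff q μ

  0P : ∀ {n} → P n
  0P = []

  _+P_ : ∀ {n} → P n → P n → P n
  p +P q = p ++ q

  -P_ : ∀ {n} → P n → P n
  -P p = map (λ { (a , ν) → (- a , ν) }) p

  _-P_ : ∀ {n} → P n → P n → P n
  p -P q = p +P (-P q)

  _*P_ : ∀ {n} → P n → P n → P n
  p *P q = concatMap (λ { (a , ν) → map (λ { (b , μ) → (a * b , zipWith ℕ._+_ ν μ) }) q }) p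

  var : ∀ {n} → Fin n → P n
  var {n} k = (1# , (replicate n 0 [ k ]≔ 1)) ∷ []

  x : ∀ {n} → SI n → P n
  x (false , k) = var k
  x (true  , k) = -P var k

  _∈⟨_⟩ : ∀ {n} → P n → P n → Set (c ⊔ ℓ)
  _∈⟨_⟩ {n} f g = Σ (P n) λ q → f ≈P (q *P g)

  InM : ∀ {n} → (Root n → Set) → (W n → P n) → Set (c ⊔ ℓ)
  InM {n} H ρ =
    ∀ (w : W n) (α : Root n) → H α →
    ∀ (p q : SI n) → p ≢ q →
    fun (refl-of α) p ≡ q → fun (refl-of α) q ≡ p →
    (ρ w -P ρ (w ∙ refl-of α)) ∈⟨ x (fun w p) -P x (fun w q) ⟩

  h : ∀ {m} → W (suc m) → P (suc m)
  h {m} w = if negCount w % 2 ≡ᵇ 1 then x (fun w (false , fromℕ m)) else 0P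

-- The parity of |Neg(w)| is the xor of the sign vector of w; since the underlying permutation of
-- s only reorders that vector, the parity is a homomorphism 𝔚ₙ → ℤ/2, and w ↦ ws changes it
-- exactly when s = (i, ī).  As e_{k+1} ≤ e_k for every k < n, a Hessenberg space containing some
-- e_k with k < n contains e_{n-1}; so t_{n-1} ∉ S(H) leaves (n, n̄) as the only (k, k̄) in S(H).
-- If s fixes n, then 𝐡(w) = 𝐡(ws).  If s is a transposition moving n, then 𝐡(w) − 𝐡(ws) is either
-- 0 or x_{w(n)} − x_{w(s(n))}.  If s = (n, n̄), then 𝐡(w) − 𝐡(ws) = x_{w(n)} = ½ (x_{w(n)} − x_{w(n̄)}).
-- Finally x_{w(p)} − x_{w(s(p))} only changes sign when p is replaced by p̄ or by s(p), and every
-- p moved by s is n or n̄ or is sent by s to one of them.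
module Submission where

open import Defs
open import Level using (Level)
open import Data.Nat using (ℕ; suc)
open import Relation.Nullary using (¬_)
open import Algebra.Bundles using (CommutativeRing)

open import Level using (_⊔_)
open import Algebra.Bundles using (CommutativeMonoid)
open import Data.Bool using (Bool; true; false; not; _xor_; _∨_; if_then_else_)
open import Data.Bool.Properties
  using (xor-same; xor-comm; xor-identityʳ; xor-∧-commutativeRing)
open import Data.Nat as ℕ using (zero; _%_; _≡ᵇ_)
import Data.Nat.Properties as ℕ
open import Data.Integer as ℤ using (ℤ; +_)
import Data.Integer.Properties as ℤ
open import Data.Fin as Fin using (Fin; zero; suc; toℕ; fromℕ; inject₁)
open import Data.Fin.Properties using (_≟_; suc-injective; toℕ-inject₁; <⇒≢; ≤fromℕ)
open import Data.Fin.Induction using (>-weakInduction)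
open import Data.Fin.Permutation using (Permutation′; permutation)
open import Data.Fin.Permutation.Components using (transpose)
open import Data.Fin.Relation.Unary.Top using (view; ‵fromℕ; ‵inj₁)
open import Data.Product using (Σ; _,_; proj₁; proj₂)
open import Data.Sum using (_⊎_; inj₁; inj₂)
open import Data.List using ([]; _∷_; _++_)
open import Data.Vec using (replicate; zipWith)
open import Data.Vec.Properties using (≡-dec; zipWith-identityˡ)
open import Data.Empty using (⊥-elim)
open import Function using (_∘_)
open import Relation.Nullary using (does; yes; no)
open import Relation.Nullary.Decidable using (dec-true; dec-false)
open import Relation.Binary.PropositionalEquality
  using (_≡_; _≢_; refl; sym; trans; cong; cong₂; subst; subst₂; module ≡-Reasoning)

xor-commutativeMonoid : CommutativeMonoid _ _
xor-commutativeMonoid = CommutativeRing.+-commutativeMonoid xor-∧-commutativeRing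

open import Algebra.Properties.CommutativeMonoid.Sum xor-commutativeMonoid
  using (sum; sum-cong-≗; sum-replicate-zero; ∑-distrib-+; sum-permute)

-- Signed permutations as a sign vector over a permutation

module _ {n : ℕ} where

  sign : W n → Fin n → Bool
  sign w i = proj₁ (fun w (false , i))

  ∣_∣ : W n → Fin n → Fin n
  ∣ w ∣ i = proj₂ (fun w (false , i))

  fun-decompose : ∀ (w : W n) b i → fun w (b , i) ≡ (b xor sign w i , ∣ w ∣ i)
  fun-decompose w false i = refl
  fun-decompose w true  i = odd w (false , i)

  ∣∣-permutation : W n → Permutation′ n
  ∣∣-permutation w = permutation ∣ w ∣ (proj₂ ∘ inv w ∘ (false ,_)) ∣∣-∣∣⁻¹ ∣∣⁻¹-∣∣
    where
    ∣∣-∣∣⁻¹ : ∀ j → ∣ w ∣ (proj₂ (inv w (false , j))) ≡ j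
    ∣∣-∣∣⁻¹ j with inv w (false , j) | fun-inv w (false , j)
    ... | b , k | w[b,k]≡j = cong proj₂ (trans (sym (fun-decompose w b k)) w[b,k]≡j)

    ∣∣⁻¹-∣∣ : ∀ i → proj₂ (inv w (false , ∣ w ∣ i)) ≡ i
    ∣∣⁻¹-∣∣ i = cong proj₂ (trans (cong (inv w) ∣w∣i≡w[σ,i]) (inv-fun w (sign w i , i)))
      where
      ∣w∣i≡w[σ,i] : (false , ∣ w ∣ i) ≡ fun w (sign w i , i)
      ∣w∣i≡w[σ,i] = sym (trans (fun-decompose w (sign w i) i)
                               (cong (_, ∣ w ∣ i) (xor-same (sign w i))))

  negParity : W n → Bool
  negParity w = sum (sign w)

  sign-∙ : ∀ (w s : W n) i → sign (w ∙ s) i ≡ sign s i xor sign w (∣ s ∣ i)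
  sign-∙ w s i = cong proj₁ (fun-decompose w (sign s i) (∣ s ∣ i))

  negParity-∙ : ∀ (w s : W n) → negParity (w ∙ s) ≡ negParity s xor negParity w
  negParity-∙ w s = begin
    sum (sign (w ∙ s))                         ≡⟨ sum-cong-≗ (sign-∙ w s) ⟩
    sum (λ i → sign s i xor sign w (∣ s ∣ i))  ≡⟨ ∑-distrib-+ (sign s) (sign w ∘ ∣ s ∣) ⟩
    negParity s xor sum (sign w ∘ ∣ s ∣)       ≡⟨ cong (negParity s xor_)
                                                       (sum-permute (sign w) (∣∣-permutation s)) ⟨
    negParity s xor negParity w                ∎
    where open ≡-Reasoning

odd-suc : ∀ k → (suc k % 2 ≡ᵇ 1) ≡ not (k % 2 ≡ᵇ 1)
odd-suc zero          = refl
odd-suc (suc zero)    = refl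
odd-suc (suc (suc k)) = odd-suc k

count-parity : ∀ {n} (f : Fin n → Bool) →
               (sumℕ (λ i → if f i then 1 else 0) % 2 ≡ᵇ 1) ≡ sum f
count-parity {zero}  f = refl
count-parity {suc n} f with f zero
... | true  = trans (odd-suc (sumℕ (λ i → if f (suc i) then 1 else 0)))
                    (cong not (count-parity (f ∘ suc)))
... | false = count-parity (f ∘ suc)

negCount-parity : ∀ {n} (w : W n) → (negCount w % 2 ≡ᵇ 1) ≡ negParity w
negCount-parity w = count-parity (sign w)

sum-indicator : ∀ {n} (i : Fin n) → sum (λ k → does (k ≟ i)) ≡ true
sum-indicator {suc n} zero    = cong (true xor_) (sum-replicate-zero n)
sum-indicator {suc n} (suc i) = sum-indicator i

module _ {n : ℕ} where

  negParity-minus : ∀ (i j : Fin n) i<j → negParity (refl-of (minus i j i<j)) ≡ false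
  negParity-minus i j i<j = sum-replicate-zero n

  negParity-plus : ∀ (i j : Fin n) i<j → negParity (refl-of (plus i j i<j)) ≡ false
  negParity-plus i j i<j = begin
    sum (λ k → does (k ≟ i) ∨ does (k ≟ j))                ≡⟨ sum-cong-≗ ∨≗xor ⟩
    sum (λ k → does (k ≟ i) xor does (k ≟ j))              ≡⟨ ∑-distrib-+ (λ k → does (k ≟ i))
                                                                           (λ k → does (k ≟ j)) ⟩
    sum (λ k → does (k ≟ i)) xor sum (λ k → does (k ≟ j))  ≡⟨ cong₂ _xor_ (sum-indicator i)
                                                                            (sum-indicator j) ⟩
    false                                                  ∎
    where
    open ≡-Reasoning
    ∨≗xor : ∀ k → (does (k ≟ i) ∨ does (k ≟ j)) ≡ (does (k ≟ i) xor does (k ≟ j))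
    ∨≗xor k with k ≟ i | k ≟ j
    ... | yes refl | yes refl = ⊥-elim (<⇒≢ i<j refl)
    ... | yes _    | no _     = refl
    ... | no _     | yes _    = refl
    ... | no _     | no _     = refl

  negParity-short : ∀ (i : Fin n) → negParity (refl-of (short i)) ≡ true
  negParity-short i = sum-indicator i

transpose-matchˡ : ∀ {n} (i j : Fin n) → transpose i j i ≡ j
transpose-matchˡ i j rewrite dec-true (i ≟ i) refl = refl

transpose-fixes : ∀ {n} {i j k : Fin n} → k ≢ i → k ≢ j → transpose i j k ≡ k
transpose-fixes {i = i} {j} {k} k≢i k≢j
  rewrite dec-false (k ≟ i) k≢i | dec-false (k ≟ j) k≢j = refl

record IsTransposition {n} (i j : Fin n) (s : W n) : Set where
  field
    i<j   : i Fin.< j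
    even  : negParity s ≡ false
    moves : ∀ b → proj₂ (fun s (b , i)) ≡ j
    fixes : ∀ b {k} → k ≢ i → k ≢ j → fun s (b , k) ≡ (b , k)

  moved-index : ∀ p → p ≢ fun s p → proj₂ p ≡ j ⊎ proj₂ (fun s p) ≡ j
  moved-index (b , k) p≢sp with k ≟ i | k ≟ j
  ... | _        | yes k≡j = inj₁ k≡j
  ... | yes refl | no _    = inj₂ (moves b)
  ... | no k≢i   | no k≢j  = ⊥-elim (p≢sp (sym (fixes b k≢i k≢j)))

minus-isTransposition : ∀ {n} (i j : Fin n) i<j → IsTransposition i j (refl-of (minus i j i<j))
minus-isTransposition i j i<j = record
  { i<j   = i<j
  ; even  = negParity-minus i j i<j
  ; moves = λ _ → transpose-matchˡ i j
  ; fixes = λ b k≢i k≢j → cong₂ _,_ (xor-identityʳ b) (transpose-fixes k≢i k≢j)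
  }

plus-isTransposition : ∀ {n} (i j : Fin n) i<j → IsTransposition i j (refl-of (plus i j i<j))
plus-isTransposition i j i<j = record
  { i<j   = i<j
  ; even  = negParity-plus i j i<j
  ; moves = λ _ → transpose-matchˡ i j
  ; fixes = fixes
  }
  where
  fixes : ∀ b {k} → k ≢ i → k ≢ j → fun (refl-of (plus i j i<j)) (b , k) ≡ (b , k)
  fixes b {k} k≢i k≢j rewrite dec-false (k ≟ i) k≢i | dec-false (k ≟ j) k≢j =
    cong (_, k) (xor-identityʳ b)

short-moved : ∀ {n} (i : Fin n) p → p ≢ fun (refl-of (short i)) p → proj₂ p ≡ i
short-moved i (b , k) p≢sp with k ≟ i
... | yes k≡i = k≡i
... | no _    = ⊥-elim (p≢sp (cong (_, k) (sym (xor-identityʳ b))))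

short-flips : ∀ {n} (i : Fin n) b → fun (refl-of (short i)) (b , i) ≡ (not b , i)
short-flips i b rewrite dec-true (i ≟ i) refl = cong (_, i) (xor-comm b true)

-- Short roots in a Hessenberg space

does-≟ : ∀ {n} (i j : Fin n) → does (i ≟ j) ≡ (toℕ j ≡ᵇ toℕ i)
does-≟ zero    zero    = refl
does-≟ zero    (suc j) = refl
does-≟ (suc i) zero    = refl
does-≟ (suc i) (suc j) = does-≟ i j

toℕ-inject₁≢ᵇlast : ∀ {n} (k : Fin (suc n)) → (toℕ (inject₁ k) ≡ᵇ suc n) ≡ false
toℕ-inject₁≢ᵇlast {n}     zero    = refl
toℕ-inject₁≢ᵇlast {suc n} (suc k) = toℕ-inject₁≢ᵇlast k

simpleVec-inject₁ : ∀ {n} t (k : Fin (suc n)) l →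
                    simpleVec t (inject₁ k) l ≡ e (inject₁ k) l ℤ.- e (suc k) l
simpleVec-inject₁ t k l
  rewrite toℕ-inject₁≢ᵇlast k | does-≟ (suc k) l | toℕ-inject₁ k = refl

-- e_k − e_{k+1} is α_k in type B and 2 α_k in type C.
shortScale : Typ → ℕ
shortScale B = 1
shortScale C = 2

rootVec-short : ∀ {n} t (i l : Fin n) → rootVec t (short i) l ≡ + shortScale t ℤ.* e i l
rootVec-short B i l = sym (ℤ.*-identityˡ (e i l))
rootVec-short C i l = refl

sumℤ-zero : ∀ {n} (f : Fin n → ℤ) → (∀ l → f l ≡ ℤ.0ℤ) → sumℤ f ≡ ℤ.0ℤ
sumℤ-zero {zero}  f f≡0 = refl
sumℤ-zero {suc n} f f≡0 = cong₂ ℤ._+_ (f≡0 zero) (sumℤ-zero (f ∘ suc) (f≡0 ∘ suc))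

sumℤ-single : ∀ {n} (f : Fin n → ℤ) k → (∀ l → l ≢ k → f l ≡ ℤ.0ℤ) → sumℤ f ≡ f k
sumℤ-single {suc n} f zero f≡0 =
  trans (cong (ℤ._+_ (f zero)) (sumℤ-zero (f ∘ suc) (λ l → f≡0 (suc l) λ ())))
        (ℤ.+-identityʳ (f zero))
sumℤ-single {suc n} f (suc k) f≡0 =
  trans (cong (ℤ._+ sumℤ (f ∘ suc)) (f≡0 zero λ ()))
        (trans (ℤ.+-identityˡ (sumℤ (f ∘ suc)))
               (sumℤ-single (f ∘ suc) k (λ l l≢k → f≡0 (suc l) (l≢k ∘ suc-injective))))

short-suc⊑short-inject₁ : ∀ {n} t (k : Fin (suc n)) → short (suc k) ⊑[ t ] short (inject₁ k)
short-suc⊑short-inject₁ t k = c , difference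
  where
  K = inject₁ k
  c : Fin _ → ℕ
  c k′ = if does (k′ ≟ K) then shortScale t else 0
  c-K : c K ≡ shortScale t
  c-K rewrite dec-true (K ≟ K) refl = refl
  off-K : ∀ l k′ → k′ ≢ K → + c k′ ℤ.* simpleVec t k′ l ≡ ℤ.0ℤ
  off-K l k′ k′≢K rewrite dec-false (k′ ≟ K) k′≢K = ℤ.*-zeroˡ (simpleVec t k′ l)
  difference : ∀ l → rootVec t (short K) l ℤ.- rootVec t (short (suc k)) l
                   ≡ sumℤ (λ k′ → + c k′ ℤ.* simpleVec t k′ l)
  difference l = begin
    rootVec t (short K) l ℤ.- rootVec t (short (suc k)) l
      ≡⟨ cong₂ ℤ._-_ (rootVec-short t K l) (rootVec-short t (suc k) l) ⟩
    + shortScale t ℤ.* e K l ℤ.- + shortScale t ℤ.* e (suc k) l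
      ≡⟨ cong (ℤ._+_ (+ shortScale t ℤ.* e K l)) (ℤ.neg-distribʳ-* (+ shortScale t) (e (suc k) l)) ⟩
    + shortScale t ℤ.* e K l ℤ.+ + shortScale t ℤ.* ℤ.- e (suc k) l
      ≡⟨ ℤ.*-distribˡ-+ (+ shortScale t) (e K l) (ℤ.- e (suc k) l) ⟨
    + shortScale t ℤ.* (e K l ℤ.- e (suc k) l)
      ≡⟨ cong₂ (λ a b → + a ℤ.* b) c-K (simpleVec-inject₁ t k l) ⟨
    + c K ℤ.* simpleVec t K l
      ≡⟨ sumℤ-single (λ k′ → + c k′ ℤ.* simpleVec t k′ l) K (off-K l) ⟨
    sumℤ (λ k′ → + c k′ ℤ.* simpleVec t k′ l)
      ∎
    where open ≡-Reasoning

module _ {m} {t : Typ} {H : Root (suc (suc m)) → Set}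
         (hess : IsHessenberg t H) (t-n-1∉S : ¬ InS H (t-n-1 m)) where

  ¬H-short-inject₁ : ∀ (k : Fin (suc m)) → ¬ H (short (inject₁ k))
  ¬H-short-inject₁ = >-weakInduction (λ k → ¬ H (short (inject₁ k))) last-excluded step
    where
    last-excluded : ¬ H (short (inject₁ (fromℕ m)))
    last-excluded H[t] = t-n-1∉S (short (inject₁ (fromℕ m)) , H[t] , λ _ → refl)
    step : ∀ k → ¬ H (short (inject₁ (suc k))) → ¬ H (short (inject₁ (inject₁ k)))
    step k ¬H[k+1] H[k] = ¬H[k+1] (proj₁ hess _ _ (short-suc⊑short-inject₁ t (inject₁ k)) H[k])

  H-short⇒last : ∀ k → H (short k) → k ≡ fromℕ (suc m)
  H-short⇒last k H[k] with view k
  ... | ‵fromℕ            = refl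
  ... | ‵inj₁ {i = k′} _  = ⊥-elim (¬H-short-inject₁ k′ H[k])

module _ {c ℓ : Level} (R : CommutativeRing c ℓ) where

  open CommutativeRing R renaming (refl to ≈-refl; sym to ≈-sym; trans to ≈-trans)
  open Poly R
  open import Algebra.Properties.Ring ring
    using (-0#≈0#; -‿involutive; -‿+-comm; -‿distribˡ-*; -‿distribʳ-*; ⁻¹-anti-homo‿-)
  open import Relation.Binary.Reasoning.Setoid setoid

  coeff-++ : ∀ {n} (p q : P n) μ → coeff (p ++ q) μ ≈ coeff p μ + coeff q μ
  coeff-++ []            q μ = ≈-sym (+-identityˡ (coeff q μ))
  coeff-++ ((a , ν) ∷ p) q μ = ≈-trans (+-congˡ (coeff-++ p q μ)) (≈-sym (+-assoc _ _ _))

  coeff-neg : ∀ {n} (p : P n) μ → coeff (-P p) μ ≈ - coeff p μ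
  coeff-neg []            μ = ≈-sym -0#≈0#
  coeff-neg ((a , ν) ∷ p) μ with does (≡-dec ℕ._≟_ ν μ)
  ... | true  = ≈-trans (+-congˡ (coeff-neg p μ)) (-‿+-comm a (coeff p μ))
  ... | false = ≈-trans (+-cong (≈-sym -0#≈0#) (coeff-neg p μ)) (-‿+-comm 0# (coeff p μ))

  coeff-sub : ∀ {n} (p q : P n) μ → coeff (p -P q) μ ≈ coeff p μ - coeff q μ
  coeff-sub p q μ = ≈-trans (coeff-++ p (-P q) μ) (+-congˡ (coeff-neg q μ))

  coeff-x-neg : ∀ {n} (z : SI n) μ → coeff (x (neg z)) μ ≈ - coeff (x z) μ
  coeff-x-neg (false , k) μ = coeff-neg (var k) μ
  coeff-x-neg (true  , k) μ =
    ≈-trans (≈-sym (-‿involutive _)) (-‿cong (≈-sym (coeff-neg (var k) μ)))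

  const : ∀ {n} → Carrier → P n
  const {n} a = (a , replicate n 0) ∷ []

  coeff-const-* : ∀ {n} a (g : P n) μ → coeff (const a *P g) μ ≈ a * coeff g μ
  coeff-const-* a []                  μ = ≈-sym (zeroʳ a)
  coeff-const-* {n} a ((b , ν) ∷ g) μ = begin
    (if [0+ν≟μ] then a * b else 0#) + coeff (const a *P g) μ
      ≈⟨ +-cong (reflexive (cong (λ ν′ → if does (≡-dec ℕ._≟_ ν′ μ) then a * b else 0#)
                                 (zipWith-identityˡ ℕ.+-identityˡ ν)))
                (coeff-const-* a g μ) ⟩
    (if [ν≟μ] then a * b else 0#) + a * coeff g μ
      ≈⟨ +-congʳ (if-* [ν≟μ]) ⟩
    a * (if [ν≟μ] then b else 0#) + a * coeff g μ
      ≈⟨ distribˡ a _ _ ⟨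
    a * coeff ((b , ν) ∷ g) μ
      ∎
    where
    [0+ν≟μ] = does (≡-dec ℕ._≟_ (zipWith ℕ._+_ (replicate n 0) ν) μ)
    [ν≟μ]   = does (≡-dec ℕ._≟_ ν μ)
    if-* : ∀ d → (if d then a * b else 0#) ≈ a * (if d then b else 0#)
    if-* true  = ≈-refl
    if-* false = ≈-sym (zeroʳ a)

  -- Every ideal membership needed for 𝐡 is witnessed by a constant multiple.
  record _∈R·_ {n} (A g : P n) : Set (c ⊔ ℓ) where
    constructor scaled
    field
      scalar  : Carrier
      coeff-≈ : ∀ μ → coeff A μ ≈ scalar * coeff g μ

  ∈R·⇒∈⟨⟩ : ∀ {n} {A g : P n} → A ∈R· g → A ∈⟨ g ⟩
  ∈R·⇒∈⟨⟩ {g = g} (scaled k A≈kg) =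
    const k , λ μ → ≈-trans (A≈kg μ) (≈-sym (coeff-const-* k g μ))

  ∈R·-neg : ∀ {n} {A g g′ : P n} → (∀ μ → coeff g′ μ ≈ - coeff g μ) → A ∈R· g → A ∈R· g′
  ∈R·-neg {A = A} {g} {g′} g′≈-g (scaled k A≈kg) = scaled (- k) λ μ → begin
    coeff A μ            ≈⟨ A≈kg μ ⟩
    k * coeff g μ        ≈⟨ -‿involutive _ ⟨
    - - (k * coeff g μ)  ≈⟨ -‿cong (-‿distribʳ-* k _) ⟩
    - (k * - coeff g μ)  ≈⟨ -‿distribˡ-* k _ ⟩
    - k * - coeff g μ    ≈⟨ *-congˡ (g′≈-g μ) ⟨
    - k * coeff g′ μ     ∎

  p-p∈R· : ∀ {n} (p g : P n) → (p -P p) ∈R· g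
  p-p∈R· p g = scaled 0# λ μ →
    ≈-trans (coeff-sub p p μ) (≈-trans (-‿inverseʳ _) (≈-sym (zeroˡ _)))

  generator : ∀ {n} → W n → W n → SI n → P n
  generator w s p = x (fun w p) -P x (fun w (fun s p))

  generator-neg : ∀ {n} (w s : W n) p μ →
                  coeff (generator w s (neg p)) μ ≈ - coeff (generator w s p) μ
  generator-neg w s p μ rewrite odd s p | odd w p | odd w (fun s p) = begin
    coeff (x (neg a) -P x (neg b)) μ           ≈⟨ coeff-sub (x (neg a)) (x (neg b)) μ ⟩
    coeff (x (neg a)) μ - coeff (x (neg b)) μ  ≈⟨ +-cong (coeff-x-neg a μ) (-‿cong (coeff-x-neg b μ)) ⟩
    - coeff (x a) μ - - coeff (x b) μ          ≈⟨ -‿+-comm _ _ ⟩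
    - (coeff (x a) μ - coeff (x b) μ)          ≈⟨ -‿cong (coeff-sub (x a) (x b) μ) ⟨
    - coeff (x a -P x b) μ                     ∎
    where
    a = fun w p
    b = fun w (fun s p)

  generator-swap : ∀ {n} (w s : W n) p → fun s (fun s p) ≡ p → ∀ μ →
                   coeff (generator w s p) μ ≈ - coeff (generator w s (fun s p)) μ
  generator-swap w s p s[s[p]]≡p μ rewrite s[s[p]]≡p = begin
    coeff (x a -P x b) μ               ≈⟨ coeff-sub (x a) (x b) μ ⟩
    coeff (x a) μ - coeff (x b) μ      ≈⟨ ⁻¹-anti-homo‿- _ _ ⟨
    - (coeff (x b) μ - coeff (x a) μ)  ≈⟨ -‿cong (coeff-sub (x b) (x a) μ) ⟨
    - coeff (x b -P x a) μ             ∎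
    where
    a = fun w p
    b = fun w (fun s p)

  char0-half : IsChar0Field → Σ Carrier λ ½ → ½ + ½ ≈ 1#
  char0-half (invertible , char0) with invertible (natCast 2) (λ 2≈0 → 2≢0 (char0 2 2≈0))
    where
    2≢0 : ¬ 2 ≡ 0
    2≢0 ()
  ... | ½ , 2*½≈1 = ½ , (begin
    ½ + ½            ≈⟨ +-cong (*-identityˡ ½) (*-identityˡ ½) ⟨
    1# * ½ + 1# * ½  ≈⟨ distribʳ ½ 1# 1# ⟨
    (1# + 1#) * ½    ≈⟨ *-congʳ (+-congˡ (+-identityʳ 1#)) ⟨
    natCast 2 * ½    ≈⟨ 2*½≈1 ⟩
    1#               ∎)

  module _ {m : ℕ} where

    n̂ : SI (suc m)
    n̂ = false , fromℕ m

    Δh : W (suc m) → W (suc m) → P (suc m)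
    Δh w s = h w -P h (w ∙ s)

    h-parity : ∀ (w : W (suc m)) → h w ≡ (if negParity w then x (fun w n̂) else 0P)
    h-parity w = cong (λ b → if b then x (fun w n̂) else 0P) (negCount-parity w)

    h-∙ : ∀ (w s : W (suc m)) →
          h (w ∙ s) ≡ (if negParity s xor negParity w then x (fun w (fun s n̂)) else 0P)
    h-∙ w s = trans (h-parity (w ∙ s))
                    (cong (λ b → if b then x (fun w (fun s n̂)) else 0P) (negParity-∙ w s))

    Δh-parities : ∀ (w s : W (suc m)) →
                  Δh w s ≡ (if negParity w then x (fun w n̂) else 0P)
                           -P (if negParity s xor negParity w then x (fun w (fun s n̂)) else 0P)
    Δh-parities w s = cong₂ _-P_ (h-parity w) (h-∙ w s)

    Δh-fixed : ∀ (w s : W (suc m)) → negParity s ≡ false → fun s n̂ ≡ n̂ → ∀ g → Δh w s ∈R· g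
    Δh-fixed w s even s[n̂]≡n̂ g =
      subst (_∈R· g) (cong (_-P_ (h w)) (sym h[ws]≡h[w])) (p-p∈R· (h w) g)
      where
      h[ws]≡h[w] : h (w ∙ s) ≡ h w
      h[ws]≡h[w] = trans (h-∙ w s)
        (trans (cong₂ (λ b z → if b xor negParity w then x (fun w z) else 0P) even s[n̂]≡n̂)
               (sym (h-parity w)))

    Δh-even : ∀ (w s : W (suc m)) → negParity s ≡ false → Δh w s ∈R· generator w s n̂
    Δh-even w s even =
      subst (_∈R· generator w s n̂)
            (sym (trans (Δh-parities w s)
                        (cong (λ b → (if negParity w then x (fun w n̂) else 0P)
                                     -P (if b xor negParity w then x (fun w (fun s n̂)) else 0P))
                              even)))
            (selected (negParity w))
      where
      selected : ∀ b → ((if b then x (fun w n̂) else 0P) -P (if b then x (fun w (fun s n̂)) else 0P))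
                       ∈R· generator w s n̂
      selected true  = scaled 1# λ μ → ≈-sym (*-identityˡ _)
      selected false = scaled 0# λ μ → ≈-sym (zeroˡ _)

    Δh-odd : ∀ (½ : Carrier) → ½ + ½ ≈ 1# → ∀ (w s : W (suc m)) →
             negParity s ≡ true → fun s n̂ ≡ neg n̂ → Δh w s ∈R· generator w s n̂
    Δh-odd ½ ½+½≈1 w s s-odd s[n̂]≡n̄ =
      subst₂ _∈R·_ (sym Δh≡) (cong (λ z′ → x z -P x z′) (sym w[s[n̂]]≡z̄)) (scaled ½ coeff-Δh)
      where
      b = negParity w
      z = fun w n̂
      w[s[n̂]]≡z̄ : fun w (fun s n̂) ≡ neg z
      w[s[n̂]]≡z̄ = trans (cong (fun w) s[n̂]≡n̄) (odd w n̂)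
      Δh≡ : Δh w s ≡ (if b then x z else 0P) -P (if not b then x (neg z) else 0P)
      Δh≡ = trans (Δh-parities w s)
                  (cong₂ (λ c z′ → (if b then x z else 0P) -P (if c xor b then x z′ else 0P))
                         s-odd w[s[n̂]]≡z̄)
      selected : ∀ b μ → coeff ((if b then x z else 0P) -P (if not b then x (neg z) else 0P)) μ
                         ≈ coeff (x z) μ
      selected true  μ = ≈-trans (coeff-++ (x z) [] μ) (+-identityʳ _)
      selected false μ = ≈-trans (coeff-neg (x (neg z)) μ)
                                 (≈-trans (-‿cong (coeff-x-neg z μ)) (-‿involutive _))
      halve : ∀ a → a ≈ ½ * (a - - a)
      halve a = ≈-sym (begin
        ½ * (a - - a)  ≈⟨ *-congˡ (+-congˡ (-‿involutive a)) ⟩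
        ½ * (a + a)    ≈⟨ distribˡ ½ a a ⟩
        ½ * a + ½ * a  ≈⟨ distribʳ a ½ ½ ⟨
        (½ + ½) * a    ≈⟨ *-congʳ ½+½≈1 ⟩
        1# * a         ≈⟨ *-identityˡ a ⟩
        a              ∎)
      coeff-Δh : ∀ μ → coeff ((if b then x z else 0P) -P (if not b then x (neg z) else 0P)) μ
                       ≈ ½ * coeff (x z -P x (neg z)) μ
      coeff-Δh μ = begin
        coeff ((if b then x z else 0P) -P (if not b then x (neg z) else 0P)) μ
          ≈⟨ selected b μ ⟩
        coeff (x z) μ
          ≈⟨ halve (coeff (x z) μ) ⟩
        ½ * (coeff (x z) μ - - coeff (x z) μ)
          ≈⟨ *-congˡ (≈-trans (coeff-sub (x z) (x (neg z)) μ) (+-congˡ (-‿cong (coeff-x-neg z μ)))) ⟨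
        ½ * coeff (x z -P x (neg z)) μ
          ∎

    ∈R·-generator-last : ∀ {A} (w s : W (suc m)) {p} → proj₂ p ≡ fromℕ m →
                         A ∈R· generator w s n̂ → A ∈R· generator w s p
    ∈R·-generator-last w s {false , _} refl A∈ = A∈
    ∈R·-generator-last w s {true  , _} refl A∈ = ∈R·-neg (generator-neg w s n̂) A∈

    ∈R·-generator-moved : ∀ {A} (w s : W (suc m)) p → fun s (fun s p) ≡ p →
                          proj₂ p ≡ fromℕ m ⊎ proj₂ (fun s p) ≡ fromℕ m →
                          A ∈R· generator w s n̂ → A ∈R· generator w s p
    ∈R·-generator-moved w s p _ (inj₁ p-last) A∈ = ∈R·-generator-last w s p-last A∈
    ∈R·-generator-moved w s p s[s[p]]≡p (inj₂ s[p]-last) A∈ =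
      ∈R·-neg (generator-swap w s p s[s[p]]≡p) (∈R·-generator-last w s s[p]-last A∈)

    Δh-transposition : ∀ {i j} (w s : W (suc m)) → IsTransposition i j s →
                       ∀ p → p ≢ fun s p → fun s (fun s p) ≡ p → Δh w s ∈R· generator w s p
    Δh-transposition {i} {j} w s T p p≢sp s[s[p]]≡p with j ≟ fromℕ m
    ... | yes refl =
      ∈R·-generator-moved w s p s[s[p]]≡p (moved-index p p≢sp) (Δh-even w s even)
      where open IsTransposition T
    ... | no j≢last = Δh-fixed w s even (fixes false last≢i (j≢last ∘ sym)) _
      where
      open IsTransposition T
      last≢i : fromℕ m ≢ i
      last≢i = <⇒≢ (ℕ.<-≤-trans i<j (≤fromℕ j)) ∘ sym

  Δh-reflection : ∀ {m t} {H : Root (suc (suc m)) → Set} →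
                  IsHessenberg t H → ¬ InS H (t-n-1 m) → (½ : Carrier) → ½ + ½ ≈ 1# →
                  ∀ w α → H α → ∀ p → p ≢ fun (refl-of α) p →
                  fun (refl-of α) (fun (refl-of α) p) ≡ p →
                  Δh w (refl-of α) ∈R· generator w (refl-of α) p
  Δh-reflection _ _ _ _ w (minus i j i<j) _ =
    Δh-transposition w _ (minus-isTransposition i j i<j)
  Δh-reflection _ _ _ _ w (plus i j i<j) _ =
    Δh-transposition w _ (plus-isTransposition i j i<j)
  Δh-reflection hess t-n-1∉S ½ ½+½≈1 w (short k) H[k] p p≢sp s[s[p]]≡p
    with H-short⇒last hess t-n-1∉S k H[k]
  ... | refl =
    ∈R·-generator-moved w (refl-of (short k)) p s[s[p]]≡p (inj₁ (short-moved k p p≢sp))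
      (Δh-odd ½ ½+½≈1 w (refl-of (short k)) (negParity-short k) (short-flips k false))

lemma6p4 : {c ℓ : Level} (R : CommutativeRing c ℓ) → Poly.IsChar0Field R →
    (m : ℕ) (t : Typ) (H : Root (suc (suc m)) → Set) →
    IsHessenberg t H →
    ¬ InS H (t-n-1 m) →
    Poly.InM R H (Poly.h R)
lemma6p4 R char0 m t H hess t-n-1∉S w α H[α] p _ p≢sp refl s[s[p]]≡p =
  ∈R·⇒∈⟨⟩ R (Δh-reflection R hess t-n-1∉S ½ ½+½≈1 w α H[α] p p≢sp s[s[p]]≡p)
  where
  open Σ (char0-half R char0) renaming (proj₁ to ½; proj₂ to ½+½≈1)
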